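{- Let $M$ be an $n\times n$ $(0,1)$-matrix that is $\epsilon$-far from binary rank at most $d$, and let $W$ be the submatrix of $M$ induced by entries $(x_1,y_1),\ldots,(x_t,y_t)$ (rows $x_1,\ldots,x_t$, columns $y_1,\ldots,y_t$). If $W$ has binary rank at most $d$, then at least one of the following holds: (1) more than $(\epsilon/3)n$ row indices $x\in[n]$ are new with respect to $W$; (2) more than $(\epsilon/3)n$ column indices $y\in[n]$ are new with respect to $W$; (3) more than $(\epsilon/3)n^2$ entries $(x,y)\in[n]\times[n]$ are new corner entries with respect to $W$.
   Context: The binary rank of a $(0,1)$-matrix is the minimal number of all-ones combinatorial rectangles needed to partition its $1$-entries. $M$ is $\epsilon$-far from binary rank at most $d$ if more than $\epsilon n^2$ entries must be modified to obtain a matrix of binary rank at most $d$. A row index $x\in[n]$ is new with respect to $W$ if $(M[x,y_1],\ldots,M[x,y_t])\ne(M[x_i,y_1],\ldots,M[x_i,y_t])$ for all $i\in[t]$; a new column index $y$ is defined analogously (its restriction $(M[x_1,y],\ldots,M[x_t,y])$ differs from that of every $y_j$). An entry $(x,y)$ such that neither $x$ nor $y$ is new with respect to $W$ is a new corner entry with respect to $W$ if there exist $i,j\in[t]$ with $(M[x,y_1],\ldots,M[x,y_t])=(M[x_i,y_1],\ldots,M[x_i,y_t])$, $(M[x_1,y],\ldots,M[x_t,y])=(M[x_1,y_j],\ldots,M[x_t,y_j])$, and $M[x,y]\ne M[x_i,y_j]$.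
   Formalization: The parameter ε ranges over the rationals. -}

module Defs where

open import Data.Bool using (Bool; true; false; _≟_)
open import Data.Nat using (ℕ; zero; suc; _+_; _*_; _≤_)
open import Data.Fin using (Fin)
import Data.Fin as Fin
import Data.Rational
open import Data.Fin.Properties using (any?; all?)
open import Data.List using (List; []; _∷_; length)
open import Data.Product using (Σ; ∃; ∃-syntax; _×_; _,_)
open import Relation.Nullary using (¬_; Dec; yes; no; does)
open import Relation.Nullary.Decidable using (_×-dec_; ¬?)
open import Relation.Unary using (Pred; Decidable)
open import Relation.Binary.PropositionalEquality using (_≡_; _≢_)
open import Data.Integer using (+_)
open import Data.Rational using (ℚ; _/_)

Matrix : ℕ → ℕ → Set
Matrix m k = Fin m → Fin k → Bool

-- A combinatorial rectangle R × C, given by indicator functions of R and C.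
Rectangle : ℕ → ℕ → Set
Rectangle m k = (Fin m → Bool) × (Fin k → Bool)

inRect : ∀ {m k} → Rectangle m k → Fin m → Fin k → Bool
inRect (R , C) x y with R x | C y
... | true | true = true
... | _    | _    = false

coverCount : ∀ {m k} → List (Rectangle m k) → Fin m → Fin k → ℕ
coverCount [] x y = 0
coverCount (r ∷ rs) x y with inRect r x y
... | true  = suc (coverCount rs x y)
... | false = coverCount rs x y

𝟙 : Bool → ℕ
𝟙 true  = 1
𝟙 false = 0

-- The list of (all-ones) rectangles partitions the 1-entries of A:
-- every 1-entry lies in exactly one rectangle, every 0-entry in none
-- (hence every rectangle is all-ones).
IsPartition : ∀ {m k} → Matrix m k → List (Rectangle m k) → Set
IsPartition A rs = ∀ x y → coverCount rs x y ≡ 𝟙 (A x y)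

BinRankAtMost : ∀ {m k} → ℕ → Matrix m k → Set
BinRankAtMost d A = ∃[ rs ] (length rs ≤ d × IsPartition A rs)

count : ∀ {n p} {P : Pred (Fin n) p} → Decidable P → ℕ
count {zero} P? = 0
count {suc n} P? with does (P? Fin.zero)
... | true  = suc (count (λ i → P? (Fin.suc i)))
... | false = count (λ i → P? (Fin.suc i))

count₂ : ∀ {n k p} {P : Fin n → Fin k → Set p} → (∀ x y → Dec (P x y)) → ℕ
count₂ {zero} P? = 0
count₂ {suc n} P? = count (P? Fin.zero) + count₂ (λ x → P? (Fin.suc x))

ℕ→ℚ : ℕ → ℚ
ℕ→ℚ k = (+ k) / 1

distance : ∀ {n} → Matrix n n → Matrix n n → ℕ
distance A B = count₂ (λ x y → ¬? (A x y ≟ B x y))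

EpsFar : ∀ {n} → ℚ → ℕ → Matrix n n → Set
EpsFar {n} ε d M =
  ∀ (M' : Matrix n n) → BinRankAtMost d M' →
    ℕ→ℚ (distance M M') Data.Rational.> ε Data.Rational.* ℕ→ℚ (n * n)

module _ {n t : ℕ} (M : Matrix n n) (xs ys : Fin t → Fin n) where

  W : Matrix t t
  W i j = M (xs i) (ys j)

  RowAgrees : Fin n → Fin t → Set
  RowAgrees x i = ∀ j → M x (ys j) ≡ M (xs i) (ys j)

  ColAgrees : Fin n → Fin t → Set
  ColAgrees y j = ∀ i → M (xs i) y ≡ M (xs i) (ys j)

  NewRow : Fin n → Set
  NewRow x = ∀ i → ¬ RowAgrees x i

  NewCol : Fin n → Set
  NewCol y = ∀ j → ¬ ColAgrees y j

  NewCorner : Fin n → Fin n → Set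
  NewCorner x y =
    ¬ NewRow x × ¬ NewCol y ×
    ∃[ i ] ∃[ j ] (RowAgrees x i × ColAgrees y j × M x y ≢ M (xs i) (ys j))

  rowAgrees? : ∀ x i → Dec (RowAgrees x i)
  rowAgrees? x i = all? (λ j → M x (ys j) ≟ M (xs i) (ys j))

  colAgrees? : ∀ y j → Dec (ColAgrees y j)
  colAgrees? y j = all? (λ i → M (xs i) y ≟ M (xs i) (ys j))

  newRow? : Decidable NewRow
  newRow? x = all? (λ i → ¬? (rowAgrees? x i))

  newCol? : Decidable NewCol
  newCol? y = all? (λ j → ¬? (colAgrees? y j))

  newCorner? : ∀ x y → Dec (NewCorner x y)
  newCorner? x y =
    ¬? (newRow? x) ×-dec ¬? (newCol? y) ×-dec
    any? (λ i → any? (λ j →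
      rowAgrees? x i ×-dec colAgrees? y j ×-dec ¬? (M x y ≟ M (xs i) (ys j))))

  numNewRows : ℕ
  numNewRows = count newRow?

  numNewCols : ℕ
  numNewCols = count newCol?

  numNewCorners : ℕ
  numNewCorners = count₂ newCorner?

-- Extend W to a matrix M' of the same binary rank: a row of M that agrees on the columns
-- y_1, …, y_t with some row x_i is copied from that row of W (likewise for columns), and
-- the entries in a new row or a new column are set to 0.  Pulling the rectangles of a
-- partition of W back along these choices partitions M', so rank M' ≤ d, and M and M'
-- can differ only in new rows, new columns and new corner entries.  Hence, if none of the
-- three counts exceeds (ε/3)n resp. (ε/3)n², M is within distance ε n² of M', contradicting
-- that M is ε-far from binary rank at most d.
module Submission where

open import Defs
open import Data.Nat using (ℕ; _*_)
open import Data.Fin using (Fin)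
open import Data.Sum using (_⊎_)
open import Data.Integer using (+_)
open import Data.Rational using (ℚ; _>_; _/_)
open import Data.Rational using () renaming (_*_ to _*ℚ_)

open import Data.Bool using (Bool; true; false; _∧_)
open import Data.Bool.Properties using (∧-zeroʳ)
open import Data.Fin using (zero; suc)
open import Data.Fin.Properties using (any?)
open import Data.Empty using (⊥)
open import Data.List using ([]; _∷_; map)
open import Data.List.Properties using (length-map)
open import Data.Maybe using (Maybe; just; nothing; maybe′)
import Data.Maybe as Maybe
open import Data.Product using (∃; _,_; proj₁; curry)
open import Data.Sum using (inj₁; inj₂; [_,_])
open import Function using (_∘_; id)
open import Relation.Nullary using (¬_; Dec; yes; no; does; contradiction)
open import Relation.Nullary.Decidable using (dec⇒maybe; _⊎-dec_)
open import Relation.Unary using (Pred; Decidable)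
open import Relation.Binary.PropositionalEquality
  using (_≡_; _≢_; refl; sym; trans; cong; cong₂; subst)
open import Data.Rational using (_<?_)
open import Data.Rational.Properties using (≤-trans; <-≤-trans; <-irrefl; ≮⇒≥)

decidable-⊎₃ : ∀ {p q r} {P : Set p} {Q : Set q} {R : Set r} →
  Dec P → Dec Q → Dec R → (¬ P → ¬ Q → ¬ R → ⊥) → P ⊎ Q ⊎ R
decidable-⊎₃ (yes p) _       _       _ = inj₁ p
decidable-⊎₃ (no ¬p) (yes q) _       _ = inj₂ (inj₁ q)
decidable-⊎₃ (no ¬p) (no ¬q) (yes r) _ = inj₂ (inj₂ r)
decidable-⊎₃ (no ¬p) (no ¬q) (no ¬r) h = contradiction ¬r (h ¬p ¬q)

module Counting where
  open import Data.Nat using (_+_; _≤_; z≤n; s≤s)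
  open import Data.Nat.Properties
  open import Algebra.Properties.CommutativeSemigroup +-commutativeSemigroup
    using (interchange)
  open ≤-Reasoning

  count-suc : ∀ {m p} {P : Pred (Fin (ℕ.suc m)) p} (P? : Decidable P) →
    count P? ≡ 𝟙 (does (P? zero)) + count (P? ∘ suc)
  count-suc P? with does (P? zero)
  ... | true  = refl
  ... | false = refl

  𝟙-does-⊎ : ∀ {p q r} {P : Set p} {Q : Set q} {R : Set r} → (P → Q ⊎ R) →
    (P? : Dec P) (Q? : Dec Q) (R? : Dec R) → 𝟙 (does P?) ≤ 𝟙 (does Q?) + 𝟙 (does R?)
  𝟙-does-⊎ h (no _)  _        _        = z≤n
  𝟙-does-⊎ h (yes _) (yes _)  _        = s≤s z≤n
  𝟙-does-⊎ h (yes _) (no _)   (yes _)  = s≤s z≤n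
  𝟙-does-⊎ h (yes p) (no ¬q)  (no ¬r)  = contradiction (h p) [ ¬q , ¬r ]

  count-⊎ : ∀ {m p q r} {P : Pred (Fin m) p} {Q : Pred (Fin m) q} {R : Pred (Fin m) r}
    (P? : Decidable P) (Q? : Decidable Q) (R? : Decidable R) →
    (∀ i → P i → Q i ⊎ R i) → count P? ≤ count Q? + count R?
  count-⊎ {ℕ.zero} P? Q? R? h = z≤n
  count-⊎ {ℕ.suc m} P? Q? R? h = begin
    count P?
      ≡⟨ count-suc P? ⟩
    𝟙 (does (P? zero)) + count (P? ∘ suc)
      ≤⟨ +-mono-≤ (𝟙-does-⊎ (h zero) (P? zero) (Q? zero) (R? zero))
                  (count-⊎ (P? ∘ suc) (Q? ∘ suc) (R? ∘ suc) (h ∘ suc)) ⟩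
    (𝟙 (does (Q? zero)) + 𝟙 (does (R? zero))) + (count (Q? ∘ suc) + count (R? ∘ suc))
      ≡⟨ interchange (𝟙 (does (Q? zero))) (𝟙 (does (R? zero)))
                     (count (Q? ∘ suc)) (count (R? ∘ suc)) ⟩
    (𝟙 (does (Q? zero)) + count (Q? ∘ suc)) + (𝟙 (does (R? zero)) + count (R? ∘ suc))
      ≡⟨ sym (cong₂ _+_ (count-suc Q?) (count-suc R?)) ⟩
    count Q? + count R? ∎

  count₂-⊎ : ∀ {m k p q r}
    {P : Fin m → Fin k → Set p} {Q : Fin m → Fin k → Set q} {R : Fin m → Fin k → Set r}
    (P? : ∀ x y → Dec (P x y)) (Q? : ∀ x y → Dec (Q x y)) (R? : ∀ x y → Dec (R x y)) →
    (∀ x y → P x y → Q x y ⊎ R x y) → count₂ P? ≤ count₂ Q? + count₂ R?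
  count₂-⊎ {ℕ.zero} P? Q? R? h = z≤n
  count₂-⊎ {ℕ.suc m} P? Q? R? h = begin
    count (P? zero) + count₂ (P? ∘ suc)
      ≤⟨ +-mono-≤ (count-⊎ (P? zero) (Q? zero) (R? zero) (h zero))
                  (count₂-⊎ (P? ∘ suc) (Q? ∘ suc) (R? ∘ suc) (h ∘ suc)) ⟩
    (count (Q? zero) + count (R? zero)) + (count₂ (Q? ∘ suc) + count₂ (R? ∘ suc))
      ≡⟨ interchange (count (Q? zero)) (count (R? zero))
                     (count₂ (Q? ∘ suc)) (count₂ (R? ∘ suc)) ⟩
    count₂ Q? + count₂ R? ∎

  count-const : ∀ {k p} {P : Set p} (P? : Dec P) →
    count {k} (λ _ → P?) ≡ 𝟙 (does P?) * k
  count-const {ℕ.zero}  P? = sym (*-zeroʳ (𝟙 (does P?)))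
  count-const {ℕ.suc k} P? = begin-equality
    count {ℕ.suc k} (λ _ → P?)       ≡⟨ count-suc (λ _ → P?) ⟩
    𝟙 (does P?) + count {k} (λ _ → P?) ≡⟨ cong (λ c → 𝟙 (does P?) + c) (count-const P?) ⟩
    𝟙 (does P?) + 𝟙 (does P?) * k      ≡⟨ sym (*-suc (𝟙 (does P?)) k) ⟩
    𝟙 (does P?) * ℕ.suc k              ∎

  count₂-row : ∀ {m k p} {P : Pred (Fin m) p} (P? : Decidable P) →
    count₂ {m} {k} (λ x _ → P? x) ≡ count P? * k
  count₂-row {ℕ.zero} P? = refl
  count₂-row {ℕ.suc m} {k} P? = begin-equality
    count {k} (λ _ → P? zero) + count₂ {m} {k} (λ x _ → P? (suc x))
      ≡⟨ cong₂ _+_ (count-const (P? zero)) (count₂-row (P? ∘ suc)) ⟩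
    𝟙 (does (P? zero)) * k + count (P? ∘ suc) * k
      ≡⟨ sym (*-distribʳ-+ k (𝟙 (does (P? zero))) (count (P? ∘ suc))) ⟩
    (𝟙 (does (P? zero)) + count (P? ∘ suc)) * k
      ≡⟨ cong (_* k) (sym (count-suc P?)) ⟩
    count P? * k ∎

  count₂-col : ∀ {m k p} {P : Pred (Fin k) p} (P? : Decidable P) →
    count₂ {m} {k} (λ _ y → P? y) ≡ m * count P?
  count₂-col {ℕ.zero}  P? = refl
  count₂-col {ℕ.suc m} P? = cong (λ c → count P? + c) (count₂-col {m} P?)

open Counting

module Pullback where
  open import Data.Nat using (_≤_)

  inRect-∧ : ∀ {m k} (R : Fin m → Bool) (C : Fin k → Bool) x y →
    inRect (R , C) x y ≡ R x ∧ C y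
  inRect-∧ R C x y with R x | C y
  ... | true  | true  = refl
  ... | true  | false = refl
  ... | false | _     = refl

  module _ {m k s u} (f : Rectangle s u → Rectangle m k) {x : Fin m} {y : Fin k} where

    coverCount-map : ∀ {i j} → (∀ ρ → inRect (f ρ) x y ≡ inRect ρ i j) →
      ∀ rs → coverCount (map f rs) x y ≡ coverCount rs i j
    coverCount-map h [] = refl
    coverCount-map {i} {j} h (ρ ∷ rs) rewrite h ρ with inRect ρ i j
    ... | true  = cong ℕ.suc (coverCount-map h rs)
    ... | false = coverCount-map h rs

    coverCount-map-outside : (∀ ρ → inRect (f ρ) x y ≡ false) →
      ∀ rs → coverCount (map f rs) x y ≡ 0
    coverCount-map-outside h [] = refl
    coverCount-map-outside h (ρ ∷ rs) rewrite h ρ = coverCount-map-outside h rs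

  extend : ∀ {s u} → Matrix s u → Maybe (Fin s) → Maybe (Fin u) → Bool
  extend A (just i) (just j) = A i j
  extend A _        _        = false

  module _ {m k s u} (r : Fin m → Maybe (Fin s)) (c : Fin k → Maybe (Fin u)) where

    pullback : Matrix s u → Matrix m k
    pullback A x y = extend A (r x) (c y)

    pullbackRect : Rectangle s u → Rectangle m k
    pullbackRect (R , C) = maybe′ R false ∘ r , maybe′ C false ∘ c

    inRect-pullbackRect : ∀ {x y a b} → r x ≡ a → c y ≡ b →
      ∀ ρ → inRect (pullbackRect ρ) x y ≡ extend (inRect ρ) a b
    inRect-pullbackRect {x} {y} refl refl (R , C)
      rewrite inRect-∧ (maybe′ R false ∘ r) (maybe′ C false ∘ c) x y with r x | c y
    ... | just i  | just j  = sym (inRect-∧ R C i j)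
    ... | just i  | nothing = ∧-zeroʳ (R i)
    ... | nothing | _       = refl

    pullback-isPartition : ∀ {A rs} → IsPartition A rs →
      IsPartition (pullback A) (map pullbackRect rs)
    pullback-isPartition {rs = rs} part x y with r x in rx | c y in cy
    ... | just i  | just j  =
      trans (coverCount-map pullbackRect (inRect-pullbackRect rx cy) rs) (part i j)
    ... | just _  | nothing = coverCount-map-outside pullbackRect (inRect-pullbackRect rx cy) rs
    ... | nothing | _       = coverCount-map-outside pullbackRect (inRect-pullbackRect rx cy) rs

    pullback-binRank : ∀ {d A} → BinRankAtMost d A → BinRankAtMost d (pullback A)
    pullback-binRank {d} (rs , |rs|≤d , part) =
      map pullbackRect rs , subst (_≤ d) (sym (length-map pullbackRect rs)) |rs|≤d ,
      pullback-isPartition {rs = rs} part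

open Pullback

module Completion {n t : ℕ} (M : Matrix n n) (xs ys : Fin t → Fin n) where
  open import Data.Nat using (_+_; _≤_)
  open import Data.Nat.Properties using (+-mono-≤; ≤-reflexive; *-comm; module ≤-Reasoning)
  open ≤-Reasoning

  witness : ∀ {p} {P : Fin t → Set p} → Dec (∃ P) → Maybe (Fin t)
  witness = Maybe.map proj₁ ∘ dec⇒maybe

  matchingRow : Fin n → Maybe (Fin t)
  matchingRow x = witness (any? (rowAgrees? M xs ys x))

  matchingCol : Fin n → Maybe (Fin t)
  matchingCol y = witness (any? (colAgrees? M xs ys y))

  completion : Matrix n n
  completion = pullback matchingRow matchingCol (W M xs ys)

  completion-binRank : ∀ {d} → BinRankAtMost d (W M xs ys) → BinRankAtMost d completion
  completion-binRank = pullback-binRank matchingRow matchingCol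

  mismatch⇒new : ∀ {x y}
    (row? : Dec (∃ (RowAgrees M xs ys x))) (col? : Dec (∃ (ColAgrees M xs ys y))) →
    M x y ≢ extend (W M xs ys) (witness row?) (witness col?) →
    NewRow M xs ys x ⊎ NewCol M xs ys y ⊎ NewCorner M xs ys x y
  mismatch⇒new (no ¬row)      _               _  = inj₁ (curry ¬row)
  mismatch⇒new (yes _)        (no ¬col)       _  = inj₂ (inj₁ (curry ¬col))
  mismatch⇒new (yes (i , ri)) (yes (j , cj)) ≢W =
    inj₂ (inj₂ ((λ new → new i ri) , (λ new → new j cj) , i , j , ri , cj , ≢W))

  distance-completion : distance M completion ≤
    numNewRows M xs ys * n + (numNewCols M xs ys * n + numNewCorners M xs ys)
  distance-completion = begin
    distance M completion
      ≤⟨ count₂-⊎ _ newRowAt? newColOrCorner?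
           (λ x y → mismatch⇒new (any? (rowAgrees? M xs ys x)) (any? (colAgrees? M xs ys y))) ⟩
    count₂ newRowAt? + count₂ newColOrCorner?
      ≤⟨ +-mono-≤ (≤-reflexive (count₂-row (newRow? M xs ys)))
                  (count₂-⊎ newColOrCorner? newColAt? (newCorner? M xs ys) (λ _ _ → id)) ⟩
    numNewRows M xs ys * n + (count₂ newColAt? + numNewCorners M xs ys)
      ≡⟨ cong (λ c → numNewRows M xs ys * n + (c + numNewCorners M xs ys))
              (trans (count₂-col {n} (newCol? M xs ys)) (*-comm n (numNewCols M xs ys))) ⟩
    numNewRows M xs ys * n + (numNewCols M xs ys * n + numNewCorners M xs ys) ∎
    where
    newRowAt? : ∀ x (y : Fin n) → Dec (NewRow M xs ys x)
    newColAt? : ∀ (x : Fin n) y → Dec (NewCol M xs ys y)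
    newColOrCorner? : ∀ x y → Dec (NewCol M xs ys y ⊎ NewCorner M xs ys x y)
    newRowAt? x _ = newRow? M xs ys x
    newColAt? _ y = newCol? M xs ys y
    newColOrCorner? x y = newColAt? x y ⊎-dec newCorner? M xs ys x y

open Completion

module ℕ→ℚ-Properties where
  import Data.Nat as ℕ
  import Data.Integer as ℤ
  import Data.Integer.Properties as ℤ
  open import Data.Rational using (_+_; _≤_; 1ℚ; toℚᵘ; NonNegative)
  open import Data.Rational.Properties
  open import Data.Rational.Unnormalised as ℚᵘ using (ℚᵘ; mkℚᵘ; *≡*; *≤*)
  import Data.Rational.Unnormalised.Properties as ℚᵘ
  open import Data.Rational.Solver using (module +-*-Solver)
  open +-*-Solver using (solve; _:+_; _:*_; _:=_)

  ℕ→ℚᵘ : ℕ → ℚᵘ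
  ℕ→ℚᵘ k = mkℚᵘ (+ k) 0

  toℚᵘ-ℕ→ℚ : ∀ k → toℚᵘ (ℕ→ℚ k) ℚᵘ.≃ ℕ→ℚᵘ k
  toℚᵘ-ℕ→ℚ k = toℚᵘ-fromℚᵘ (ℕ→ℚᵘ k)

  ℕ→ℚ-homo-+ : ∀ a b → ℕ→ℚ (a ℕ.+ b) ≡ ℕ→ℚ a + ℕ→ℚ b
  ℕ→ℚ-homo-+ a b = toℚᵘ-injective (begin
    toℚᵘ (ℕ→ℚ (a ℕ.+ b))                ≈⟨ toℚᵘ-ℕ→ℚ (a ℕ.+ b) ⟩
    ℕ→ℚᵘ (a ℕ.+ b)                       ≈⟨ *≡* (cong (ℤ._* + 1) numerators) ⟩
    ℕ→ℚᵘ a ℚᵘ.+ ℕ→ℚᵘ b                   ≈⟨ ℚᵘ.+-cong (toℚᵘ-ℕ→ℚ a) (toℚᵘ-ℕ→ℚ b) ⟨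
    toℚᵘ (ℕ→ℚ a) ℚᵘ.+ toℚᵘ (ℕ→ℚ b)     ≈⟨ toℚᵘ-homo-+ (ℕ→ℚ a) (ℕ→ℚ b) ⟨
    toℚᵘ (ℕ→ℚ a + ℕ→ℚ b)                ∎)
    where
    open ℚᵘ.≃-Reasoning
    numerators : + (a ℕ.+ b) ≡ + a ℤ.* + 1 ℤ.+ + b ℤ.* + 1
    numerators = trans (ℤ.pos-+ a b) (sym (cong₂ ℤ._+_ (ℤ.*-identityʳ (+ a)) (ℤ.*-identityʳ (+ b))))

  ℕ→ℚ-homo-* : ∀ a b → ℕ→ℚ (a ℕ.* b) ≡ ℕ→ℚ a *ℚ ℕ→ℚ b
  ℕ→ℚ-homo-* a b = toℚᵘ-injective (begin
    toℚᵘ (ℕ→ℚ (a ℕ.* b))                ≈⟨ toℚᵘ-ℕ→ℚ (a ℕ.* b) ⟩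
    ℕ→ℚᵘ (a ℕ.* b)                       ≈⟨ *≡* (cong (ℤ._* + 1) (ℤ.pos-* a b)) ⟩
    ℕ→ℚᵘ a ℚᵘ.* ℕ→ℚᵘ b                   ≈⟨ ℚᵘ.*-cong (toℚᵘ-ℕ→ℚ a) (toℚᵘ-ℕ→ℚ b) ⟨
    toℚᵘ (ℕ→ℚ a) ℚᵘ.* toℚᵘ (ℕ→ℚ b)     ≈⟨ toℚᵘ-homo-* (ℕ→ℚ a) (ℕ→ℚ b) ⟨
    toℚᵘ (ℕ→ℚ a *ℚ ℕ→ℚ b)               ∎)
    where open ℚᵘ.≃-Reasoning

  ℕ→ℚ-mono-≤ : ∀ {a b} → a ℕ.≤ b → ℕ→ℚ a ≤ ℕ→ℚ b
  ℕ→ℚ-mono-≤ {a} {b} a≤b = toℚᵘ-cancel-≤ (begin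
    toℚᵘ (ℕ→ℚ a) ≃⟨ toℚᵘ-ℕ→ℚ a ⟩
    ℕ→ℚᵘ a       ≤⟨ *≤* (ℤ.*-monoʳ-≤-nonNeg (+ 1) (ℤ.+≤+ a≤b)) ⟩
    ℕ→ℚᵘ b       ≃⟨ toℚᵘ-ℕ→ℚ b ⟨
    toℚᵘ (ℕ→ℚ b) ∎)
    where open ℚᵘ.≤-Reasoning

  three-thirds : + 1 / 3 + + 1 / 3 + + 1 / 3 ≡ 1ℚ
  three-thirds = refl

  module _ (ε : ℚ) (n : ℕ) where
    private
      c N : ℚ
      c = ε *ℚ (+ 1 / 3)
      N = ℕ→ℚ n
      instance
        N-nonNeg : NonNegative N
        N-nonNeg = normalize-nonNeg n 1

    scale-≤ : ∀ a → ℕ→ℚ a ≤ c *ℚ N → ℕ→ℚ (a ℕ.* n) ≤ c *ℚ ℕ→ℚ (n ℕ.* n)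
    scale-≤ a a≤cN = begin
      ℕ→ℚ (a ℕ.* n)       ≡⟨ ℕ→ℚ-homo-* a n ⟩
      ℕ→ℚ a *ℚ N          ≤⟨ *-monoʳ-≤-nonNeg N a≤cN ⟩
      c *ℚ N *ℚ N         ≡⟨ *-assoc c N N ⟩
      c *ℚ (N *ℚ N)       ≡⟨ cong (c *ℚ_) (ℕ→ℚ-homo-* n n) ⟨
      c *ℚ ℕ→ℚ (n ℕ.* n) ∎
      where open ≤-Reasoning

    thirds-≤ : ∀ a b k → ℕ→ℚ a ≤ c *ℚ N → ℕ→ℚ b ≤ c *ℚ N → ℕ→ℚ k ≤ c *ℚ ℕ→ℚ (n ℕ.* n) →
      ℕ→ℚ (a ℕ.* n ℕ.+ (b ℕ.* n ℕ.+ k)) ≤ ε *ℚ ℕ→ℚ (n ℕ.* n)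
    thirds-≤ a b k a≤cN b≤cN k≤cK = begin
      ℕ→ℚ (a ℕ.* n ℕ.+ (b ℕ.* n ℕ.+ k))
        ≡⟨ trans (ℕ→ℚ-homo-+ (a ℕ.* n) (b ℕ.* n ℕ.+ k))
                 (cong (λ q → ℕ→ℚ (a ℕ.* n) + q) (ℕ→ℚ-homo-+ (b ℕ.* n) k)) ⟩
      ℕ→ℚ (a ℕ.* n) + (ℕ→ℚ (b ℕ.* n) + ℕ→ℚ k)
        ≤⟨ +-mono-≤ (scale-≤ a a≤cN) (+-mono-≤ (scale-≤ b b≤cN) k≤cK) ⟩
      c *ℚ K + (c *ℚ K + c *ℚ K)
        ≡⟨ solve 3 (λ e t K → e :* t :* K :+ (e :* t :* K :+ e :* t :* K) := e :* (t :+ t :+ t) :* K)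
                 refl ε (+ 1 / 3) K ⟩
      ε *ℚ (+ 1 / 3 + + 1 / 3 + + 1 / 3) *ℚ K
        ≡⟨ cong (λ q → ε *ℚ q *ℚ K) three-thirds ⟩
      ε *ℚ 1ℚ *ℚ K
        ≡⟨ cong (_*ℚ K) (*-identityʳ ε) ⟩
      ε *ℚ K ∎
      where
      open ≤-Reasoning
      K : ℚ
      K = ℕ→ℚ (n ℕ.* n)

open ℕ→ℚ-Properties

claim6 : ∀ (n d t : ℕ) (ε : ℚ) (M : Matrix n n) (xs ys : Fin t → Fin n) →
    EpsFar ε d M →
    BinRankAtMost d (W M xs ys) →
    (ℕ→ℚ (numNewRows M xs ys) > (ε *ℚ (+ 1 / 3)) *ℚ ℕ→ℚ n)
    ⊎ (ℕ→ℚ (numNewCols M xs ys) > (ε *ℚ (+ 1 / 3)) *ℚ ℕ→ℚ n)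
    ⊎ (ℕ→ℚ (numNewCorners M xs ys) > (ε *ℚ (+ 1 / 3)) *ℚ ℕ→ℚ (n * n))
claim6 n d t ε M xs ys far rank =
  decidable-⊎₃ (_ <? _) (_ <? _) (_ <? _) λ few-rows few-cols few-corners →
    <-irrefl refl (<-≤-trans (far (completion M xs ys) (completion-binRank M xs ys rank))
      (≤-trans (ℕ→ℚ-mono-≤ (distance-completion M xs ys))
               (thirds-≤ ε n (numNewRows M xs ys) (numNewCols M xs ys) (numNewCorners M xs ys)
                 (≮⇒≥ few-rows) (≮⇒≥ few-cols) (≮⇒≥ few-corners))))
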